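{- Let $M$ be the infinite lower triangular matrix with entries $M_{n,k}=[\gcd(n+1,k)=1]\,[k\le n]$ for $n,k\ge1$. There is a unique lower triangular array $(\mu_{n,k})_{n,k\ge1}$ (with $\mu_{n,d}=0$ whenever $n<d$) such that for every $N\ge1$ the matrix $(\mu_{n,k})_{1\le n,k\le N}$ is the inverse of $(M_{n,k})_{1\le n,k\le N}$, i.e. $\mu^{(-1)}_{n,k}=[\gcd(n+1,k)=1][k\le n]$. Moreover, for arithmetic functions $f,g$ the following inversion relation holds: if $g(n)=\sum_{1\le d\le n,\ \gcd(d,n)=1}f(d)$ for all $n\ge2$, then $f(n)=\sum_{d=1}^{n}g(d+1)\,\mu_{n,d}$ for all $n\ge1$; and conversely, if $f(n)=\sum_{d=1}^{n}g(d+1)\,\mu_{n,d}$ for all $n\ge1$, then $g(n)=\sum_{1\le d\le n,\ \gcd(d,n)=1}f(d)$ for all $n\ge2$.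
   Context: $[P]$ denotes the Iverson bracket ($1$ if $P$ holds, $0$ otherwise). An arithmetic function is a map $\mathbb{N}\to\mathbb{C}$. -}

module Defs where

open import Data.Nat using (ℕ; zero; suc; _≡ᵇ_; _≤ᵇ_; _≤_; _<_)
open import Data.Nat.GCD using (gcd)
open import Data.Bool using (Bool; true; false; if_then_else_)
open import Data.Product using (_×_)
open import Algebra.Bundles using (Ring)

-- Iverson-bracket / finite-sum notions, valued in an arbitrary ring R
-- (the paper's arithmetic functions are ℂ-valued; ℂ is one such ring).
module RingDefs {c ℓ} (R : Ring c ℓ) where
  open Ring R

  ⟦_⟧ : Bool → Carrier
  ⟦ b ⟧ = if b then 1# else 0#

  sum1to : ℕ → (ℕ → Carrier) → Carrier
  sum1to zero    f = 0#
  sum1to (suc n) f = sum1to n f + f (suc n)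

  δ : ℕ → ℕ → Carrier
  δ n k = ⟦ n ≡ᵇ k ⟧

  M : ℕ → ℕ → Carrier
  M n k = ⟦ gcd (suc n) k ≡ᵇ 1 ⟧ * ⟦ k ≤ᵇ n ⟧

  coprimeSum : (ℕ → Carrier) → ℕ → Carrier
  coprimeSum f n = sum1to n (λ d → ⟦ gcd d n ≡ᵇ 1 ⟧ * f d)

  LowerTriangular : (ℕ → ℕ → Carrier) → Set ℓ
  LowerTriangular μ = ∀ n d → 1 ≤ n → n < d → μ n d ≈ 0#

  InverseOfM : (ℕ → ℕ → Carrier) → Set ℓ
  InverseOfM μ = ∀ N n k → 1 ≤ N → 1 ≤ n → n ≤ N → 1 ≤ k → k ≤ N →
      (sum1to N (λ j → μ n j * M j k) ≈ δ n k) × (sum1to N (λ j → M n j * μ j k) ≈ δ n k)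

-- The whole argument is linear algebra of unitriangular matrices over an
-- arbitrary ring R, with one twist: R need not be commutative, so we keep
-- track of which entries are central.
module Submission where

open import Defs
open import Data.Nat using (ℕ; suc; _≤_)
open import Data.Product using (Σ; _×_)
open import Algebra.Bundles using (Ring)

open import Data.Nat as ℕ using (zero; _<_; z≤n; s≤s; _≡ᵇ_; _≤ᵇ_)
import Data.Nat.Properties as ℕₚ
open import Data.Nat.GCD using (gcd; gcd-comm; gcd[m,n]∣m; gcd-greatest)
open import Data.Nat.Divisibility using (∣-refl; ∣-antisym)
open import Data.Nat.Coprimality using (Coprime; coprime⇒gcd≡1; coprime-+; 1-coprimeTo)
open import Data.Bool using (true; false; if_then_else_; T)
open import Data.Unit using (tt)
open import Data.Empty using (⊥-elim)
open import Data.Sum using (inj₁; inj₂)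
open import Data.Product using (_,_; proj₂)
open import Relation.Nullary using (¬_; yes; no)
open import Relation.Binary.PropositionalEquality as ≡ using (_≡_; _≢_)
open import Data.Nat.Induction using (<-rec)
open import Level using (_⊔_)

if-true : ∀ {a} {A : Set a} {b} {x y : A} → T b → (if b then x else y) ≡ x
if-true {b = true} _ = ≡.refl

if-false : ∀ {a} {A : Set a} {b} {x y : A} → ¬ T b → (if b then x else y) ≡ y
if-false {b = true}  ¬t = ⊥-elim (¬t tt)
if-false {b = false} _  = ≡.refl

-- Consecutive integers are coprime; this makes the diagonal of M equal to 1.
gcd[1+n,n]≡1 : ∀ n → gcd (suc n) n ≡ 1
gcd[1+n,n]≡1 n =
  coprime⇒gcd≡1 (≡.subst (λ m → Coprime m n) (ℕₚ.+-comm n 1) (coprime-+ (1-coprimeTo n)))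

gcd[n,n]≡n : ∀ n → gcd n n ≡ n
gcd[n,n]≡n n = ∣-antisym (gcd[m,n]∣m n n) (gcd-greatest ∣-refl ∣-refl)

module _ {c ℓ} (R : Ring c ℓ) where
  open Ring R
  open RingDefs R
  open import Relation.Binary.Reasoning.Setoid setoid
  open import Algebra.Properties.Ring R
  open import Algebra.Properties.CommutativeSemigroup +-commutativeSemigroup using (interchange)

  ⟦true⟧ : ∀ {b} → T b → ⟦ b ⟧ ≈ 1#
  ⟦true⟧ {true} _ = refl

  ⟦false⟧ : ∀ {b} → ¬ T b → ⟦ b ⟧ ≈ 0#
  ⟦false⟧ {true}  ¬t = ⊥-elim (¬t tt)
  ⟦false⟧ {false} _  = refl

  δ-diag : ∀ n → δ n n ≈ 1#
  δ-diag n = ⟦true⟧ (ℕₚ.≡⇒≡ᵇ n n ≡.refl)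

  δ-off : ∀ n k → n ≢ k → δ n k ≈ 0#
  δ-off n k n≢k = ⟦false⟧ (λ t → n≢k (ℕₚ.≡ᵇ⇒≡ n k t))

  sum-cong : ∀ N {h h′ : ℕ → Carrier} →
             (∀ j → 1 ≤ j → j ≤ N → h j ≈ h′ j) → sum1to N h ≈ sum1to N h′
  sum-cong zero    _   = refl
  sum-cong (suc N) h≈h′ =
    +-cong (sum-cong N (λ j 1≤j j≤N → h≈h′ j 1≤j (ℕₚ.m≤n⇒m≤1+n j≤N)))
           (h≈h′ (suc N) (s≤s z≤n) ℕₚ.≤-refl)

  sum-cong′ : ∀ N {h h′ : ℕ → Carrier} → (∀ j → h j ≈ h′ j) → sum1to N h ≈ sum1to N h′
  sum-cong′ N h≈h′ = sum-cong N (λ j _ _ → h≈h′ j)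

  sum-zero : ∀ N {h : ℕ → Carrier} → (∀ j → 1 ≤ j → j ≤ N → h j ≈ 0#) → sum1to N h ≈ 0#
  sum-zero zero    _   = refl
  sum-zero (suc N) h≈0 = begin
    sum1to N _ + _ ≈⟨ +-cong (sum-zero N (λ j 1≤j j≤N → h≈0 j 1≤j (ℕₚ.m≤n⇒m≤1+n j≤N)))
                             (h≈0 (suc N) (s≤s z≤n) ℕₚ.≤-refl) ⟩
    0# + 0#        ≈⟨ +-identityʳ 0# ⟩
    0#             ∎

  sum-+ : ∀ N (h h′ : ℕ → Carrier) → sum1to N (λ j → h j + h′ j) ≈ sum1to N h + sum1to N h′
  sum-+ zero    h h′ = sym (+-identityʳ 0#)
  sum-+ (suc N) h h′ = trans (+-cong (sum-+ N h h′) refl) (interchange _ _ _ _)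

  sum-neg : ∀ N (h : ℕ → Carrier) → sum1to N (λ j → - h j) ≈ - sum1to N h
  sum-neg zero    h = sym -0#≈0#
  sum-neg (suc N) h = trans (+-cong (sum-neg N h) refl) (-‿+-comm _ _)

  sum-*ˡ : ∀ N x (h : ℕ → Carrier) → x * sum1to N h ≈ sum1to N (λ j → x * h j)
  sum-*ˡ zero    x h = zeroʳ x
  sum-*ˡ (suc N) x h = trans (distribˡ x _ _) (+-cong (sum-*ˡ N x h) refl)

  sum-*ʳ : ∀ N x (h : ℕ → Carrier) → sum1to N h * x ≈ sum1to N (λ j → h j * x)
  sum-*ʳ zero    x h = zeroˡ x
  sum-*ʳ (suc N) x h = trans (distribʳ x _ _) (+-cong (sum-*ʳ N x h) refl)

  sum-*-− : ∀ N (a b b′ : ℕ → Carrier) →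
            sum1to N (λ j → a j * (b j - b′ j)) ≈ sum1to N (λ j → a j * b j) - sum1to N (λ j → a j * b′ j)
  sum-*-− N a b b′ = begin
    sum1to N (λ j → a j * (b j - b′ j))         ≈⟨ sum-cong′ N (λ j → x[y-z]≈xy-xz (a j) (b j) (b′ j)) ⟩
    sum1to N (λ j → a j * b j - a j * b′ j)     ≈⟨ sum-+ N _ _ ⟩
    _ + sum1to N (λ j → - (a j * b′ j))         ≈⟨ +-cong refl (sum-neg N _) ⟩
    _                                           ∎

  sum-swap : ∀ P Q (a : ℕ → ℕ → Carrier) →
             sum1to P (λ i → sum1to Q (a i)) ≈ sum1to Q (λ j → sum1to P (λ i → a i j))
  sum-swap zero    Q a = sym (sum-zero Q (λ _ _ _ → refl))
  sum-swap (suc P) Q a =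
    trans (+-cong (sum-swap P Q a) refl) (sym (sum-+ Q (λ j → sum1to P (λ i → a i j)) (a (suc P))))

  sum-assoc : ∀ P Q (a : ℕ → Carrier) (b : ℕ → ℕ → Carrier) (v : ℕ → Carrier) →
              sum1to P (λ j → a j * sum1to Q (λ d → b j d * v d))
              ≈ sum1to Q (λ d → sum1to P (λ j → a j * b j d) * v d)
  sum-assoc P Q a b v = begin
    sum1to P (λ j → a j * sum1to Q (λ d → b j d * v d))
      ≈⟨ sum-cong′ P (λ j → trans (sum-*ˡ Q (a j) _) (sum-cong′ Q (λ d → sym (*-assoc _ _ _)))) ⟩
    sum1to P (λ j → sum1to Q (λ d → a j * b j d * v d))
      ≈⟨ sum-swap P Q _ ⟩
    sum1to Q (λ d → sum1to P (λ j → a j * b j d * v d))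
      ≈⟨ sum-cong′ Q (λ d → sym (sum-*ʳ P (v d) _)) ⟩
    sum1to Q (λ d → sum1to P (λ j → a j * b j d) * v d) ∎

  sum-truncate : ∀ n N {h : ℕ → Carrier} → n ≤ N →
                 (∀ j → n < j → j ≤ N → h j ≈ 0#) → sum1to N h ≈ sum1to n h
  sum-truncate n zero    z≤n _   = refl
  sum-truncate n (suc N) n≤1+N h≈0 with n ℕₚ.≟ suc N
  ... | yes ≡.refl = refl
  ... | no  n≢1+N  = begin
    sum1to N _ + _  ≈⟨ +-cong (sum-truncate n N (ℕₚ.≤-pred n<1+N)
                                 (λ j n<j j≤N → h≈0 j n<j (ℕₚ.m≤n⇒m≤1+n j≤N)))
                              (h≈0 (suc N) n<1+N ℕₚ.≤-refl) ⟩
    sum1to n _ + 0# ≈⟨ +-identityʳ _ ⟩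
    sum1to n _      ∎
    where
    n<1+N : n < suc N
    n<1+N = ℕₚ.≤∧≢⇒< n≤1+N n≢1+N

  sum-single : ∀ N k {h : ℕ → Carrier} → 1 ≤ k → k ≤ N →
               (∀ j → 1 ≤ j → j ≤ N → j ≢ k → h j ≈ 0#) → sum1to N h ≈ h k
  sum-single N (suc k) {h} _ 1+k≤N h≈0 = begin
    sum1to N h             ≈⟨ sum-truncate (suc k) N 1+k≤N
                                (λ j k<j j≤N → h≈0 j (ℕₚ.≤-trans (s≤s z≤n) k<j) j≤N
                                                 (λ j≡1+k → ℕₚ.<-irrefl (≡.sym j≡1+k) k<j)) ⟩
    sum1to k h + h (suc k) ≈⟨ +-cong (sum-zero k (λ j 1≤j j≤k → h≈0 j 1≤j (ℕₚ.≤-trans (ℕₚ.m≤n⇒m≤1+n j≤k) 1+k≤N)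
                                                   (λ j≡1+k → ℕₚ.<-irrefl j≡1+k (s≤s j≤k)))) refl ⟩
    0# + h (suc k)         ≈⟨ +-identityˡ _ ⟩
    h (suc k)              ∎

  sum-δˡ : ∀ N n (h : ℕ → Carrier) → 1 ≤ n → n ≤ N → sum1to N (λ j → δ n j * h j) ≈ h n
  sum-δˡ N n h 1≤n n≤N = begin
    sum1to N (λ j → δ n j * h j) ≈⟨ sum-single N n 1≤n n≤N
                                      (λ j _ _ j≢n → trans (*-cong (δ-off n j (λ n≡j → j≢n (≡.sym n≡j))) refl) (zeroˡ _)) ⟩
    δ n n * h n                  ≈⟨ trans (*-cong (δ-diag n) refl) (*-identityˡ _) ⟩
    h n                          ∎

  sum-δʳ : ∀ N k (h : ℕ → Carrier) → 1 ≤ k → k ≤ N → sum1to N (λ j → h j * δ j k) ≈ h k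
  sum-δʳ N k h 1≤k k≤N = begin
    sum1to N (λ j → h j * δ j k) ≈⟨ sum-single N k 1≤k k≤N (λ j _ _ j≢k → trans (*-cong refl (δ-off j k j≢k)) (zeroʳ _)) ⟩
    h k * δ k k                  ≈⟨ trans (*-cong refl (δ-diag k)) (*-identityʳ _) ⟩
    h k                          ∎

  Central : Carrier → Set (c ⊔ ℓ)
  Central x = ∀ y → x * y ≈ y * x

  central-0 : Central 0#
  central-0 y = trans (zeroˡ y) (sym (zeroʳ y))

  central-1 : Central 1#
  central-1 y = trans (*-identityˡ y) (sym (*-identityʳ y))

  central-+ : ∀ {x z} → Central x → Central z → Central (x + z)
  central-+ cx cz y = trans (distribʳ y _ _) (trans (+-cong (cx y) (cz y)) (sym (distribˡ y _ _)))

  central-* : ∀ {x z} → Central x → Central z → Central (x * z)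
  central-* {x} {z} cx cz y = begin
    x * z * y   ≈⟨ *-assoc _ _ _ ⟩
    x * (z * y) ≈⟨ *-cong refl (cz y) ⟩
    x * (y * z) ≈⟨ sym (*-assoc _ _ _) ⟩
    x * y * z   ≈⟨ *-cong (cx y) refl ⟩
    y * x * z   ≈⟨ *-assoc _ _ _ ⟩
    y * (x * z) ∎

  central-neg : ∀ {x} → Central x → Central (- x)
  central-neg {x} cx y = begin
    - x * y   ≈⟨ sym (-‿distribˡ-* _ _) ⟩
    - (x * y) ≈⟨ -‿cong (cx y) ⟩
    - (y * x) ≈⟨ -‿distribʳ-* _ _ ⟩
    y * - x   ∎

  central-⟦⟧ : ∀ b → Central ⟦ b ⟧
  central-⟦⟧ true  = central-1
  central-⟦⟧ false = central-0

  central-sum : ∀ N {h : ℕ → Carrier} → (∀ j → 1 ≤ j → j ≤ N → Central (h j)) → Central (sum1to N h)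
  central-sum zero    _  = central-0
  central-sum (suc N) ch = central-+ (central-sum N (λ j 1≤j j≤N → ch j 1≤j (ℕₚ.m≤n⇒m≤1+n j≤N)))
                                     (ch (suc N) (s≤s z≤n) ℕₚ.≤-refl)

  central-resp : ∀ {x y} → x ≈ y → Central y → Central x
  central-resp {x} {y} x≈y cy z = begin
    x * z ≈⟨ *-cong x≈y refl ⟩
    y * z ≈⟨ cy z ⟩
    z * y ≈⟨ *-cong refl (sym x≈y) ⟩
    z * x ∎

  module Unitriangular (A : ℕ → ℕ → Carrier)
                       (A-diag : ∀ n → A n n ≈ 1#)
                       (A-upper : ∀ n j → n < j → A n j ≈ 0#)
                       (A-central : ∀ n j → Central (A n j)) where

    row-truncate : ∀ N n (x : ℕ → Carrier) → n ≤ N →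
                   sum1to N (λ j → A n j * x j) ≈ sum1to n (λ j → A n j * x j)
    row-truncate N n x n≤N =
      sum-truncate n N n≤N (λ j n<j _ → trans (*-cong (A-upper n j n<j) refl) (zeroˡ _))

    -- Forward substitution: table n holds the first n rows of the inverse,
    -- μ (n+1) k = δ (n+1) k - Σ_{j ≤ n} A (n+1) j μ j k.
    table : ℕ → ℕ → ℕ → Carrier
    table zero    i k = 0#
    table (suc n) i k =
      if i ≤ᵇ n then table n i k
      else δ (suc n) k - sum1to n (λ j → A (suc n) j * table n j k)

    μ : ℕ → ℕ → Carrier
    μ n k = table n n k

    table-stable : ∀ n j k → j ≤ n → table n j k ≡ μ j k
    table-stable zero    zero k z≤n   = ≡.refl
    table-stable (suc n) j    k j≤1+n with ℕₚ.m≤n⇒m<n∨m≡n j≤1+n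
    ... | inj₂ ≡.refl = ≡.refl
    ... | inj₁ j<1+n  = ≡.trans (if-true (ℕₚ.≤⇒≤ᵇ j≤n)) (table-stable n j k j≤n)
      where
      j≤n : j ≤ n
      j≤n = ℕₚ.≤-pred j<1+n

    μ-recurrence : ∀ n k → μ (suc n) k ≈ δ (suc n) k - sum1to n (λ j → A (suc n) j * μ j k)
    μ-recurrence n k = begin
      μ (suc n) k
        ≡⟨ if-false (λ t → ℕₚ.<-irrefl ≡.refl (ℕₚ.≤ᵇ⇒≤ (suc n) n t)) ⟩
      δ (suc n) k - sum1to n (λ j → A (suc n) j * table n j k)
        ≈⟨ +-cong refl (-‿cong (sum-cong n (λ j _ j≤n →
             reflexive (≡.cong (A (suc n) j *_) (table-stable n j k j≤n))))) ⟩
      δ (suc n) k - sum1to n (λ j → A (suc n) j * μ j k) ∎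

    μ-central : ∀ n k → Central (μ n k)
    μ-central = <-rec (λ n → ∀ k → Central (μ n k)) step
      where
      step : ∀ n → (∀ {j} → j < n → ∀ k → Central (μ j k)) → ∀ k → Central (μ n k)
      step zero    _   k = central-0
      step (suc n) rec k = central-resp (μ-recurrence n k)
        (central-+ (central-⟦⟧ _) (central-neg (central-sum n (λ j _ j≤n →
          central-* (A-central (suc n) j) (rec (s≤s j≤n) k)))))

    μ-lower : ∀ n k → n < k → μ n k ≈ 0#
    μ-lower = <-rec (λ n → ∀ k → n < k → μ n k ≈ 0#) step
      where
      step : ∀ n → (∀ {j} → j < n → ∀ k → j < k → μ j k ≈ 0#) → ∀ k → n < k → μ n k ≈ 0#
      step zero    _   k _     = refl
      step (suc n) rec k 1+n<k = begin
        μ (suc n) k                                        ≈⟨ μ-recurrence n k ⟩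
        δ (suc n) k - sum1to n (λ j → A (suc n) j * μ j k) ≈⟨ +-cong (δ-off (suc n) k (ℕₚ.<⇒≢ 1+n<k))
                                                                (-‿cong (sum-zero n (λ j _ j≤n →
                                                                  trans (*-cong refl (rec (s≤s j≤n) k (j<k j≤n))) (zeroʳ _)))) ⟩
        0# - 0#                                            ≈⟨ -‿inverseʳ 0# ⟩
        0#                                                 ∎
        where
        j<k : ∀ {j} → j ≤ n → j < k
        j<k j≤n = ℕₚ.<-trans (s≤s j≤n) 1+n<k

    -- A μ = 1 on every leading block: the recurrence is exactly this identity.
    right-inverse : ∀ N n k → 1 ≤ n → n ≤ N → sum1to N (λ j → A n j * μ j k) ≈ δ n k
    right-inverse N (suc m) k _ 1+m≤N = begin
      sum1to N (λ j → A (suc m) j * μ j k)  ≈⟨ row-truncate N (suc m) (λ j → μ j k) 1+m≤N ⟩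
      S + A (suc m) (suc m) * μ (suc m) k   ≈⟨ +-cong refl (trans (*-cong (A-diag (suc m)) (μ-recurrence m k)) (*-identityˡ _)) ⟩
      S + (δ (suc m) k - S)                 ≈⟨ +-cong refl (+-comm _ _) ⟩
      S + (- S + δ (suc m) k)               ≈⟨ sym (+-assoc _ _ _) ⟩
      S - S + δ (suc m) k                   ≈⟨ +-cong (-‿inverseʳ S) refl ⟩
      0# + δ (suc m) k                      ≈⟨ +-identityˡ _ ⟩
      δ (suc m) k                           ∎
      where
      S : Carrier
      S = sum1to m (λ j → A (suc m) j * μ j k)

    block-injective : ∀ N (x : ℕ → Carrier) → (∀ n → 1 ≤ n → n ≤ N → sum1to N (λ j → A n j * x j) ≈ 0#) →
                      ∀ n → 1 ≤ n → n ≤ N → x n ≈ 0#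
    block-injective N x Ax≈0 n 1≤n n≤N = vanishes-upto n n≤N n 1≤n ℕₚ.≤-refl
      where
      vanishes-upto : ∀ m → m ≤ N → ∀ n → 1 ≤ n → n ≤ m → x n ≈ 0#
      vanishes-upto zero    _     n 1≤n n≤0 = ⊥-elim (ℕₚ.<-irrefl ≡.refl (ℕₚ.<-≤-trans 1≤n n≤0))
      vanishes-upto (suc m) 1+m≤N n 1≤n n≤1+m with ℕₚ.m≤n⇒m<n∨m≡n n≤1+m
      ... | inj₁ n<1+m  = vanishes-upto m m≤N n 1≤n (ℕₚ.≤-pred n<1+m)
        where
        m≤N : m ≤ N
        m≤N = ℕₚ.≤-trans (ℕₚ.n≤1+n m) 1+m≤N
      ... | inj₂ ≡.refl = begin
        x (suc m)                                 ≈⟨ sym (+-identityˡ _) ⟩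
        0# + x (suc m)                            ≈⟨ +-cong (sym (sum-zero m (λ j 1≤j j≤m →
                                                       trans (*-cong refl (vanishes-upto m m≤N j 1≤j j≤m)) (zeroʳ _))))
                                                     (sym (trans (*-cong (A-diag (suc m)) refl) (*-identityˡ _))) ⟩
        sum1to (suc m) (λ j → A (suc m) j * x j)  ≈⟨ sym (row-truncate N (suc m) x 1+m≤N) ⟩
        sum1to N (λ j → A (suc m) j * x j)        ≈⟨ Ax≈0 (suc m) 1≤n 1+m≤N ⟩
        0#                                        ∎
        where
        m≤N : m ≤ N
        m≤N = ℕₚ.≤-trans (ℕₚ.n≤1+n m) 1+m≤N

    -- μ A = 1 on every leading block: A (μ A - 1) = A - A = 0, and A is injective.
    left-inverse : ∀ N n k → 1 ≤ n → n ≤ N → 1 ≤ k → k ≤ N → sum1to N (λ j → μ n j * A j k) ≈ δ n k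
    left-inverse N n k 1≤n n≤N 1≤k k≤N =
      x∙y⁻¹≈ε⇒x≈y _ _ (block-injective N defect A-defect≈0 n 1≤n n≤N)
      where
      defect : ℕ → Carrier
      defect j = sum1to N (λ i → μ j i * A i k) - δ j k
      A-defect≈0 : ∀ m → 1 ≤ m → m ≤ N → sum1to N (λ j → A m j * defect j) ≈ 0#
      A-defect≈0 m 1≤m m≤N = begin
        sum1to N (λ j → A m j * defect j)
          ≈⟨ sum-*-− N _ _ _ ⟩
        sum1to N (λ j → A m j * sum1to N (λ i → μ j i * A i k)) - sum1to N (λ j → A m j * δ j k)
          ≈⟨ +-cong (sum-assoc N N (A m) μ (λ i → A i k)) (-‿cong (sum-δʳ N k (A m) 1≤k k≤N)) ⟩
        sum1to N (λ i → sum1to N (λ j → A m j * μ j i) * A i k) - A m k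
          ≈⟨ +-cong (sum-cong′ N (λ i → *-cong (right-inverse N m i 1≤m m≤N) refl)) refl ⟩
        sum1to N (λ i → δ m i * A i k) - A m k
          ≈⟨ +-cong (sum-δˡ N m (λ i → A i k) 1≤m m≤N) refl ⟩
        A m k - A m k
          ≈⟨ -‿inverseʳ _ ⟩
        0# ∎

    right-inverse-unique : ∀ (ν : ℕ → ℕ → Carrier) →
                           (∀ N n k → 1 ≤ n → n ≤ N → 1 ≤ k → k ≤ N → sum1to N (λ j → A n j * ν j k) ≈ δ n k) →
                           ∀ n k → 1 ≤ n → 1 ≤ k → ν n k ≈ μ n k
    right-inverse-unique ν Aν≈1 n k 1≤n 1≤k =
      x∙y⁻¹≈ε⇒x≈y _ _ (block-injective N difference A-difference≈0 n 1≤n (ℕₚ.m≤m+n n k))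
      where
      N : ℕ
      N = n ℕ.+ k
      difference : ℕ → Carrier
      difference j = ν j k - μ j k
      A-difference≈0 : ∀ m → 1 ≤ m → m ≤ N → sum1to N (λ j → A m j * difference j) ≈ 0#
      A-difference≈0 m 1≤m m≤N = begin
        sum1to N (λ j → A m j * difference j)                              ≈⟨ sum-*-− N _ _ _ ⟩
        sum1to N (λ j → A m j * ν j k) - sum1to N (λ j → A m j * μ j k)    ≈⟨ +-cong (Aν≈1 N m k 1≤m m≤N 1≤k (ℕₚ.m≤n+m k n))
                                                                                    (-‿cong (right-inverse N m k 1≤m m≤N)) ⟩
        δ m k - δ m k                                                      ≈⟨ -‿inverseʳ _ ⟩
        0#                                                                 ∎

    μ-row-truncate : ∀ j m (y : ℕ → Carrier) → j ≤ m →
                     sum1to m (λ d → μ j d * y d) ≈ sum1to j (λ d → μ j d * y d)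
    μ-row-truncate j m y j≤m =
      sum-truncate j m j≤m (λ d j<d _ → trans (*-cong (μ-lower j d j<d) refl) (zeroˡ _))

    solve : ∀ (u v : ℕ → Carrier) → (∀ d → 1 ≤ d → u d ≈ sum1to d (λ j → A d j * v j)) →
            ∀ n → 1 ≤ n → v n ≈ sum1to n (λ d → μ n d * u d)
    solve u v u≈Av n 1≤n = sym (begin
      sum1to n (λ d → μ n d * u d)
        ≈⟨ sum-cong n (λ d 1≤d d≤n → *-cong refl (trans (u≈Av d 1≤d) (sym (row-truncate n d v d≤n)))) ⟩
      sum1to n (λ d → μ n d * sum1to n (λ j → A d j * v j))
        ≈⟨ sum-assoc n n (μ n) A v ⟩
      sum1to n (λ j → sum1to n (λ d → μ n d * A d j) * v j)
        ≈⟨ sum-cong n (λ j 1≤j j≤n → *-cong (left-inverse n n j 1≤n ℕₚ.≤-refl 1≤j j≤n) refl) ⟩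
      sum1to n (λ j → δ n j * v j)
        ≈⟨ sum-δˡ n n v 1≤n ℕₚ.≤-refl ⟩
      v n ∎)

    unsolve : ∀ (u v : ℕ → Carrier) → (∀ n → 1 ≤ n → v n ≈ sum1to n (λ d → μ n d * u d)) →
              ∀ m → 1 ≤ m → u m ≈ sum1to m (λ j → A m j * v j)
    unsolve u v v≈μu m 1≤m = sym (begin
      sum1to m (λ j → A m j * v j)
        ≈⟨ sum-cong m (λ j 1≤j j≤m → *-cong refl (trans (v≈μu j 1≤j) (sym (μ-row-truncate j m u j≤m)))) ⟩
      sum1to m (λ j → A m j * sum1to m (λ d → μ j d * u d))
        ≈⟨ sum-assoc m m (A m) μ u ⟩
      sum1to m (λ d → sum1to m (λ j → A m j * μ j d) * u d)
        ≈⟨ sum-cong′ m (λ d → *-cong (right-inverse m m d 1≤m ℕₚ.≤-refl) refl) ⟩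
      sum1to m (λ d → δ m d * u d)
        ≈⟨ sum-δˡ m m u 1≤m ℕₚ.≤-refl ⟩
      u m ∎)

  M-diag : ∀ n → M n n ≈ 1#
  M-diag n = trans (*-cong (⟦true⟧ (ℕₚ.≡⇒≡ᵇ _ 1 (gcd[1+n,n]≡1 n))) (⟦true⟧ (ℕₚ.≤⇒≤ᵇ (ℕₚ.≤-refl {n}))))
                   (*-identityˡ 1#)

  M-upper : ∀ n j → n < j → M n j ≈ 0#
  M-upper n j n<j = trans (*-cong refl (⟦false⟧ (λ t → ℕₚ.<⇒≱ n<j (ℕₚ.≤ᵇ⇒≤ j n t)))) (zeroʳ _)

  M-central : ∀ n j → Central (M n j)
  M-central n j = central-* (central-⟦⟧ _) (central-⟦⟧ _)

  -- For d ≥ 1 the coprime sum over 1 ≤ j ≤ d+1 is row d of M applied to f: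
  -- the term j = d+1 drops out since gcd(d+1,d+1) = d+1 ≠ 1.
  coprimeSum-row : ∀ (f : ℕ → Carrier) d → 1 ≤ d → coprimeSum f (suc d) ≈ sum1to d (λ j → M d j * f j)
  coprimeSum-row f d 1≤d = begin
    coprimeSum f (suc d)                                  ≈⟨ +-cong refl (trans (*-cong (⟦false⟧ gcd≢1) refl) (zeroˡ _)) ⟩
    sum1to d (λ j → ⟦ gcd j (suc d) ≡ᵇ 1 ⟧ * f j) + 0#    ≈⟨ +-identityʳ _ ⟩
    sum1to d (λ j → ⟦ gcd j (suc d) ≡ᵇ 1 ⟧ * f j)         ≈⟨ sum-cong d (λ j _ j≤d → *-cong (bracket≈M j j≤d) refl) ⟩
    sum1to d (λ j → M d j * f j)                          ∎
    where
    gcd≢1 : ¬ T (gcd (suc d) (suc d) ≡ᵇ 1)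
    gcd≢1 t = ℕₚ.<-irrefl (≡.trans (≡.sym (ℕₚ.≡ᵇ⇒≡ _ 1 t)) (gcd[n,n]≡n (suc d))) (s≤s 1≤d)
    bracket≈M : ∀ j → j ≤ d → ⟦ gcd j (suc d) ≡ᵇ 1 ⟧ ≈ M d j
    bracket≈M j j≤d rewrite gcd-comm j (suc d) =
      sym (trans (*-cong refl (⟦true⟧ (ℕₚ.≤⇒≤ᵇ j≤d))) (*-identityʳ _))

  module M⁻¹ = Unitriangular M M-diag M-upper M-central
  open M⁻¹ using (μ; μ-central)

  μ-lowerTriangular : LowerTriangular μ
  μ-lowerTriangular n d _ n<d = M⁻¹.μ-lower n d n<d

  μ-inverseOfM : InverseOfM μ
  μ-inverseOfM N n k _ 1≤n n≤N 1≤k k≤N =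
    M⁻¹.left-inverse N n k 1≤n n≤N 1≤k k≤N , M⁻¹.right-inverse N n k 1≤n n≤N

  -- An inverse of M is in particular a right inverse, hence equal to μ.
  inverseOfM-unique : ∀ (μ′ : ℕ → ℕ → Carrier) → LowerTriangular μ′ → InverseOfM μ′ →
                      ∀ n k → 1 ≤ n → 1 ≤ k → μ′ n k ≈ μ n k
  inverseOfM-unique μ′ _ μ′-inverse = M⁻¹.right-inverse-unique μ′ (λ N n k 1≤n n≤N 1≤k k≤N →
    proj₂ (μ′-inverse N n k (ℕₚ.≤-trans 1≤n n≤N) 1≤n n≤N 1≤k k≤N))

  coprimeSum-inversion : ∀ (f g : ℕ → Carrier) → (∀ n → 2 ≤ n → g n ≈ coprimeSum f n) →
                         ∀ n → 1 ≤ n → f n ≈ sum1to n (λ d → g (suc d) * μ n d)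
  coprimeSum-inversion f g g≈Sf n 1≤n = begin
    f n                                  ≈⟨ M⁻¹.solve (λ d → g (suc d)) f g[1+d]≈Mf n 1≤n ⟩
    sum1to n (λ d → μ n d * g (suc d))   ≈⟨ sum-cong′ n (λ d → μ-central n d (g (suc d))) ⟩
    sum1to n (λ d → g (suc d) * μ n d)   ∎
    where
    g[1+d]≈Mf : ∀ d → 1 ≤ d → g (suc d) ≈ sum1to d (λ j → M d j * f j)
    g[1+d]≈Mf d 1≤d = trans (g≈Sf (suc d) (s≤s 1≤d)) (coprimeSum-row f d 1≤d)

  coprimeSum-inversion⁻¹ : ∀ (f g : ℕ → Carrier) → (∀ n → 1 ≤ n → f n ≈ sum1to n (λ d → g (suc d) * μ n d)) →
                           ∀ n → 2 ≤ n → g n ≈ coprimeSum f n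
  coprimeSum-inversion⁻¹ f g f≈gμ (suc m) (s≤s 1≤m) = begin
    g (suc m)                       ≈⟨ M⁻¹.unsolve (λ d → g (suc d)) f f≈μg m 1≤m ⟩
    sum1to m (λ j → M m j * f j)    ≈⟨ coprimeSum-row f m 1≤m ⟨
    coprimeSum f (suc m)            ∎
    where
    f≈μg : ∀ n → 1 ≤ n → f n ≈ sum1to n (λ d → μ n d * g (suc d))
    f≈μg n 1≤n = trans (f≈gμ n 1≤n) (sum-cong′ n (λ d → sym (μ-central n d (g (suc d)))))

proposition3p1 : ∀ {c ℓ} (R : Ring c ℓ) →
    let open Ring R
        open RingDefs R
    in Σ (ℕ → ℕ → Carrier) λ μ →
      (LowerTriangular μ × InverseOfM μ)
      × (∀ (μ′ : ℕ → ℕ → Carrier) → LowerTriangular μ′ → InverseOfM μ′ →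
           ∀ n k → 1 ≤ n → 1 ≤ k → μ′ n k ≈ μ n k)
      × (∀ (f g : ℕ → Carrier) →
           ((∀ n → 2 ≤ n → g n ≈ coprimeSum f n) →
              ∀ n → 1 ≤ n → f n ≈ sum1to n (λ d → g (suc d) * μ n d))
         × ((∀ n → 1 ≤ n → f n ≈ sum1to n (λ d → g (suc d) * μ n d)) →
              ∀ n → 2 ≤ n → g n ≈ coprimeSum f n))
proposition3p1 R =
  M⁻¹.μ R , (μ-lowerTriangular R , μ-inverseOfM R) , inverseOfM-unique R ,
  λ f g → coprimeSum-inversion R f g , coprimeSum-inversion⁻¹ R f g
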